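{- Let $n,d\ge1$ be integers and $p$ a prime with $p\nmid d$. Then $h_{j,\epsilon}\ge 0$ for all $j\in\{0,1,\dots,nd\}$ and $\epsilon\in\{0,1\}$.
   Context: For $j\in\mathbb Z$ let $h_j=\#\{u\in\{1,\dots,d-1\}^n : u_1+\cdots+u_n=j\}$ (so $h_j=0$ unless $0\le j\le nd$). For an integer $m\le nd$ let $H_m=\sum_{t\ge0}h_{m-td}$ (so $H_m=0$ for $m<0$). For $j\in\{0,\dots,nd\}$ let $\sigma_j(0)$ be the unique integer with $j-\sigma_j(0)\equiv p^{ -1}j\pmod d$ ($p^{ -1}$ the inverse of $p$ mod $d$) lying in $\{0,\dots,d-1\}$ if $(p-1)j\not\equiv0\pmod d$ and in $\{1,\dots,d\}$ if $(p-1)j\equiv0\pmod d$. The Frobenius numbers are $h_{j,0}=H_j-H_{j-\sigma_j(0)}$ and $h_{j,1}=H_{j-\sigma_j(0)}-H_{j-d}$. -}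

module Defs where

open import Data.Nat as ℕ using (ℕ; zero; suc; _∸_; NonZero; _≟_)
open import Data.Nat.DivMod using (_%_)
open import Data.Integer as ℤ using (ℤ; +_; -[1+_]; _%ℕ_)
open import Data.List using (List; []; _∷_; map; concatMap; upTo; filter; length)
open import Data.Nat.ListAction using (sum)
open import Data.Bool using (if_then_else_)
open import Relation.Nullary.Decidable using (⌊_⌋)

digits : ℕ → List ℕ
digits d = map suc (upTo (d ∸ 1))

tuples : ℕ → ℕ → List (List ℕ)
tuples zero    d = [] ∷ []
tuples (suc n) d = concatMap (λ a → map (a ∷_) (tuples n d)) (digits d)

hℕ : ℕ → ℕ → ℕ → ℕ
hℕ n d j = length (filter (λ u → sum u ≟ j) (tuples n d))

-- h_j for integer j (zero for negative j, since all such sums are ≥ 0)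
h : ℕ → ℕ → ℤ → ℕ
h n d (+ j)    = hℕ n d j
h n d -[1+ _ ] = 0

-- H_m = Σ_{t ≥ 0} h_{m - t d}.  For m < 0 this is 0; for m ≥ 0 and d ≥ 1 every
-- term with t > m has m - t d < 0, so summing t = 0,…,m gives the full sum.
H : ℕ → ℕ → ℤ → ℤ
H n d (+ m)    = + sum (map (λ t → h n d (+ m ℤ.- + (t ℕ.* d))) (upTo (suc m)))
H n d -[1+ _ ] = + 0

-- p^{-1} mod d : the least q ∈ {0,…,d-1} with p q ≡ 1 (mod d)
-- (exists and is unique mod d when gcd(p,d) = 1; default 0 otherwise)
invMod : (p d : ℕ) → .{{NonZero d}} → ℕ
invMod p d with filter (λ q → ((p ℕ.* q) % d) ≟ (1 % d)) (upTo d)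
... | []    = 0
... | q ∷ _ = q

-- σ_j(0): the unique integer ≡ j - p^{-1} j (mod d) in {0,…,d-1} if
-- (p-1) j ≢ 0 (mod d), and in {1,…,d} if (p-1) j ≡ 0 (mod d).
σ0 : (p d : ℕ) → .{{NonZero d}} → ℕ → ℕ
σ0 p d j =
  let r = (+ j ℤ.- + (invMod p d ℕ.* j)) %ℕ d in
  if ⌊ ((p ∸ 1) ℕ.* j) % d ≟ 0 ⌋
    then (if ⌊ r ≟ 0 ⌋ then d else r)
    else r

hFrob0 : (n d p : ℕ) → .{{NonZero d}} → ℕ → ℤ
hFrob0 n d p j = H n d (+ j) ℤ.- H n d (+ j ℤ.- + σ0 p d j)

hFrob1 : (n d p : ℕ) → .{{NonZero d}} → ℕ → ℤ
hFrob1 n d p j = H n d (+ j ℤ.- + σ0 p d j) ℤ.- H n d (+ j ℤ.- + d)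

module Submission where

-- The Frobenius numbers h_{j,0} = H_j − H_{j−σ} and h_{j,1} = H_{j−σ} − H_{j−d},
-- σ = σ_j(0), are differences of values of H_m = Σ_{t≥0} h_{m−td}, so the theorem
-- amounts to two inequalities between values of H.
--
-- Splitting off the first entry of a tuple gives
--     h^{(n+1)}_x = Σ_{a=1}^{d−1} h^{(n)}_{x−a}; shifting this window by one gives
--     h^{(n+1)}_x + h^{(n)}_{x−d} = h^{(n+1)}_{x−1} + h^{(n)}_{x−1} (`h-step`).
--     Writing H as a long enough finite sum and summing termwise yields the same
--     identity for H (`H-step`), and also H_x = h_x + H_{x−d} (`H-unfold`).
-- (2) Monotonicity.  By induction on n, H^{(n)} is non-decreasing on the
--     non-multiples of d (`H-mono`): H^{(0)} vanishes there, and `H-step` bounds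
--     the increments of H^{(n+1)} over k → k+1, or over k → k+2 across a
--     multiple of d, by such comparisons for H^{(n)} (`monotone-off-multiples`).
-- (3) Arithmetic of σ.  σ ≤ d; σ = d when d ∣ j; otherwise j − σ ≡ p⁻¹j (mod d)
--     is not a multiple of d, because p⁻¹ is invertible modulo d.
-- Combining (2) and (3) gives H_{j−d} ≤ H_{j−σ} ≤ H_j, i.e. the theorem.

open import Defs
open import Data.Nat using (ℕ; NonZero; _≤_; _*_)
open import Data.Nat.Divisibility using (_∣_)
open import Data.Nat.Primality using (Prime)
open import Data.Integer using (+_) renaming (_≤_ to _≤ℤ_)
open import Data.Product using (_×_)
open import Relation.Nullary using (¬_)

import Data.Nat as ℕ
open import Data.Nat using (zero; suc; _+_; _∸_; _<_; _≟_; _≤?_; z≤n; s≤s)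
import Data.Nat.Properties as ℕₚ
open import Data.Nat.Tactic.RingSolver as ℕ-Solver using ()
open import Data.Nat.DivMod using (_%_; m%n<n; m%n%n≡m%n; %-distribˡ-*; [m+n]%n≡m%n; [m+kn]%n≡m%n)
open import Data.Nat.Divisibility
  using (_∣?_; divides; ∣-refl; ∣1⇒≡1; ∣m+n∣m⇒∣n; ∣m∸n∣n⇒∣m; 1∣_; ∣n⇒∣m*n; m%n≡0⇒n∣m; n∣m⇒m%n≡0; ∣⇒≤)
open import Data.Nat.Primality using (prime⇒irreducible)
open import Data.Nat.Coprimality using (Coprime; coprime-Bézout)
open import Data.Nat.GCD using (module Bézout)
open import Data.Nat.ListAction using (sum)
open import Data.Integer as ℤ using (ℤ; -[1+_]; 0ℤ; 1ℤ; -1ℤ; ∣_∣; _%ℕ_; _/ℕ_)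
import Data.Integer.Properties as ℤₚ
open import Data.Integer.Tactic.RingSolver as ℤ-Solver using ()
open import Data.Integer.DivMod using (n%ℕd<d; a≡a%ℕn+[a/ℕn]*n)
import Data.Integer.Divisibility.Signed as ℤ∣
open ℤ∣ using () renaming (_∣_ to _∣ℤ_)
open import Data.List using (List; []; _∷_; _++_; map; concatMap; filter; length; upTo; applyUpTo)
import Data.List.Properties as Listₚ
import Data.List.Relation.Unary.All as All
open import Data.List.Relation.Unary.Any using (here)
open import Data.List.Membership.Propositional using (_∈_)
open import Data.List.Membership.Propositional.Properties using (∈-upTo⁺; ∈-filter⁺; ∈-filter⁻)
open import Data.Product using (_,_; ∃; proj₂)
open import Data.Sum using (_⊎_; inj₁; inj₂)
open import Data.Bool using (true; false)
open import Data.Empty using (⊥; ⊥-elim)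
open import Function using (_∘_)
open import Level using (0ℓ)
open import Relation.Nullary using (does; yes; no)
open import Relation.Unary using (Pred; Decidable)
open import Relation.Binary.PropositionalEquality
open ≡-Reasoning

∑ : (ℕ → ℕ) → ℕ → ℕ
∑ f N = sum (applyUpTo f N)

∑-cong : ∀ {f g : ℕ → ℕ} → (∀ t → f t ≡ g t) → ∀ N → ∑ f N ≡ ∑ g N
∑-cong f≗g zero    = refl
∑-cong f≗g (suc N) = cong₂ _+_ (f≗g 0) (∑-cong (f≗g ∘ suc) N)

∑-zero : ∀ {f : ℕ → ℕ} → (∀ t → f t ≡ 0) → ∀ N → ∑ f N ≡ 0
∑-zero f≗0 zero    = refl
∑-zero f≗0 (suc N) = cong₂ _+_ (f≗0 0) (∑-zero (f≗0 ∘ suc) N)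

∑-truncate : ∀ (f : ℕ → ℕ) {M N} → M ≤ N → (∀ t → M ≤ t → f t ≡ 0) → ∑ f N ≡ ∑ f M
∑-truncate f {zero}  {N} _     vanish = ∑-zero (λ t → vanish t z≤n) N
∑-truncate f {suc M} (s≤s M≤N) vanish =
  cong (_+_ (f 0)) (∑-truncate (f ∘ suc) M≤N (λ t M≤t → vanish (suc t) (s≤s M≤t)))

∑-+ : ∀ (f g : ℕ → ℕ) N → ∑ (λ t → f t + g t) N ≡ ∑ f N + ∑ g N
∑-+ f g zero    = refl
∑-+ f g (suc N) =
  trans (cong (_+_ (f 0 + g 0)) (∑-+ (f ∘ suc) (g ∘ suc) N)) (interchange (f 0) (g 0) _ _)
  where
  interchange : ∀ a b c e → a + b + (c + e) ≡ a + c + (b + e)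
  interchange = ℕ-Solver.solve-∀

∑-last : ∀ (f : ℕ → ℕ) N → ∑ f (suc N) ≡ ∑ f N + f N
∑-last f zero    = ℕₚ.+-identityʳ (f 0)
∑-last f (suc N) = trans (cong (_+_ (f 0)) (∑-last (f ∘ suc) N)) (sym (ℕₚ.+-assoc (f 0) _ _))

module _ {A : Set} {P : Pred A 0ℓ} (P? : Decidable P) where

  count : List A → ℕ
  count xs = length (filter P? xs)

  count-++ : ∀ xs ys → count (xs ++ ys) ≡ count xs + count ys
  count-++ xs ys = trans (cong length (Listₚ.filter-++ P? xs ys)) (Listₚ.length-++ (filter P? xs))

  count-concatMap : ∀ {B : Set} (f : B → List A) bs →
                    count (concatMap f bs) ≡ sum (map (count ∘ f) bs)
  count-concatMap f []       = refl
  count-concatMap f (b ∷ bs) =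
    trans (count-++ (f b) (concatMap f bs)) (cong (_+_ (count (f b))) (count-concatMap f bs))

  count-map : ∀ {B : Set} (g : B → A) bs → count (map g bs) ≡ length (filter (P? ∘ g) bs)
  count-map g []       = refl
  count-map g (b ∷ bs) with does (P? (g b))
  ... | true  = cong suc (count-map g bs)
  ... | false = count-map g bs

sub-suc : ∀ x k → x ℤ.- + suc k ≡ (x ℤ.- 1ℤ) ℤ.- + k
sub-suc x k = trans (cong (ℤ._-_ x) (ℤₚ.pos-+ 1 k)) (regroup x (+ k))
  where
  regroup : ∀ x y → x ℤ.- (1ℤ ℤ.+ y) ≡ (x ℤ.- 1ℤ) ℤ.- y
  regroup = ℤ-Solver.solve-∀

sub-swap : ∀ x a b → (x ℤ.- a) ℤ.- b ≡ (x ℤ.- b) ℤ.- a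
sub-swap = ℤ-Solver.solve-∀

sub-≤ : ∀ x k → x ℤ.- + k ℤ.≤ x
sub-≤ x k = ℤₚ.i-j≤i x (+ k)

sub-nat : ∀ {x e} → e ≤ x → + x ℤ.- + e ≡ + (x ∸ e)
sub-nat {x} {e} e≤x = trans (ℤₚ.m-n≡m⊖n x e) (ℤₚ.⊖-≥ e≤x)

sub-neg : ∀ {x e} → x < e → + x ℤ.- + e ℤ.< 0ℤ
sub-neg {x} {e} x<e =
  subst₂ ℤ._<_ (sym (ℤₚ.m-n≡m⊖n x e)) (ℤₚ.n⊖n≡0 x) (ℤₚ.⊖-monoʳ->-< x x<e)

sub-sub : ∀ x y → x ℤ.- (x ℤ.- y) ≡ y
sub-sub = ℤ-Solver.solve-∀

-- a natural number bound N with x < N, used as summation length for H_x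
below-bound : ∀ x → x ℤ.< + suc ∣ x ∣
below-bound (+ m)    = ℤ.+<+ (ℕₚ.n<1+n m)
below-bound -[1+ _ ] = ℤ.-<+

move-summand : ∀ a s x → + (a + s) ≡ x → + s ≡ x ℤ.- + a
move-summand a s x eq =
  trans (sym (cancel (+ a) (+ s))) (cong (ℤ._- + a) (trans (sym (ℤₚ.pos-+ a s)) eq))
  where
  cancel : ∀ a s → (a ℤ.+ s) ℤ.- a ≡ s
  cancel = ℤ-Solver.solve-∀

unmove-summand : ∀ a s x → + s ≡ x ℤ.- + a → + (a + s) ≡ x
unmove-summand a s x eq = trans (ℤₚ.pos-+ a s) (trans (cong (ℤ._+_ (+ a)) eq) (cancel (+ a) x))
  where
  cancel : ∀ a x → a ℤ.+ (x ℤ.- a) ≡ x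
  cancel = ℤ-Solver.solve-∀

h-neg : ∀ n d x → x ℤ.< 0ℤ → h n d x ≡ 0
h-neg n d -[1+ _ ] _        = refl
h-neg n d (+ _)    (ℤ.+<+ ())

h-zero : ∀ d x → x ≢ 0ℤ → h 0 d x ≡ 0
h-zero d (+ zero)  x≢0 = ⊥-elim (x≢0 refl)
h-zero d (+ suc k) _   = refl
h-zero d -[1+ k ]  _   = refl

-- h_x counts the tuples with entry sum x; in this form it also covers negative x.
h-count : ∀ n d x → h n d x ≡ count (λ u → + sum u ℤ.≟ x) (tuples n d)
h-count n d (+ k)    = cong length (Listₚ.filter-≐ (λ u → sum u ≟ k) (λ u → + sum u ℤ.≟ + k)
                                      (cong (λ s → + s) , ℤₚ.+-injective) (tuples n d))
h-count n d -[1+ k ] = sym (cong length (Listₚ.filter-none _ (All.universal (λ _ ()) (tuples n d))))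

h-suc : ∀ n d x → h (suc n) d x ≡ ∑ (λ a → h n d (x ℤ.- + suc a)) (d ∸ 1)
h-suc n d x = begin
  h (suc n) d x
    ≡⟨ h-count (suc n) d x ⟩
  count sum≡x? (concatMap (λ a → map (a ∷_) (tuples n d)) (digits d))
    ≡⟨ count-concatMap sum≡x? _ (digits d) ⟩
  sum (map (λ a → count sum≡x? (map (a ∷_) (tuples n d))) (digits d))
    ≡⟨ cong sum (Listₚ.map-cong first-entry (digits d)) ⟩
  sum (map (λ a → h n d (x ℤ.- + a)) (map suc (upTo (d ∸ 1))))
    ≡⟨ cong sum (trans (sym (Listₚ.map-∘ (upTo (d ∸ 1)))) (Listₚ.map-upTo _ (d ∸ 1))) ⟩
  ∑ (λ a → h n d (x ℤ.- + suc a)) (d ∸ 1) ∎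
  where
  sum≡x? = λ (u : List ℕ) → + sum u ℤ.≟ x
  -- tuples with first entry a and sum x ↔ tuples with sum x − a
  first-entry : ∀ a → count sum≡x? (map (a ∷_) (tuples n d)) ≡ h n d (x ℤ.- + a)
  first-entry a = begin
    count sum≡x? (map (a ∷_) (tuples n d))
      ≡⟨ count-map sum≡x? (a ∷_) (tuples n d) ⟩
    length (filter (sum≡x? ∘ (a ∷_)) (tuples n d))
      ≡⟨ cong length (Listₚ.filter-≐ _ _ (move-summand a _ x , unmove-summand a _ x) (tuples n d)) ⟩
    count (λ u → + sum u ℤ.≟ x ℤ.- + a) (tuples n d)
      ≡⟨ h-count n d (x ℤ.- + a) ⟨
    h n d (x ℤ.- + a) ∎

window-shift : ∀ (f : ℤ → ℕ) x c →
  ∑ (λ a → f (x ℤ.- + suc a)) c + f (x ℤ.- + suc c) ≡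
  f (x ℤ.- 1ℤ) + ∑ (λ a → f ((x ℤ.- 1ℤ) ℤ.- + suc a)) c
window-shift f x c = trans (sym (∑-last (λ a → f (x ℤ.- + suc a)) c))
  (cong (_+_ (f (x ℤ.- 1ℤ))) (∑-cong (λ a → cong f (sub-suc x (suc a))) c))

h-step : ∀ n c x →
  h (suc n) (suc c) x + h n (suc c) (x ℤ.- + suc c) ≡
  h (suc n) (suc c) (x ℤ.- 1ℤ) + h n (suc c) (x ℤ.- 1ℤ)
h-step n c x = begin
  h (suc n) d x + h n d (x ℤ.- + d)
    ≡⟨ cong (_+ h n d (x ℤ.- + d)) (h-suc n d x) ⟩
  ∑ (λ a → h n d (x ℤ.- + suc a)) c + h n d (x ℤ.- + d)
    ≡⟨ window-shift (h n d) x c ⟩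
  h n d (x ℤ.- 1ℤ) + ∑ (λ a → h n d ((x ℤ.- 1ℤ) ℤ.- + suc a)) c
    ≡⟨ ℕₚ.+-comm (h n d (x ℤ.- 1ℤ)) _ ⟩
  ∑ (λ a → h n d ((x ℤ.- 1ℤ) ℤ.- + suc a)) c + h n d (x ℤ.- 1ℤ)
    ≡⟨ cong (_+ h n d (x ℤ.- 1ℤ)) (h-suc n d (x ℤ.- 1ℤ)) ⟨
  h (suc n) d (x ℤ.- 1ℤ) + h n d (x ℤ.- 1ℤ) ∎
  where d = suc c

prime∤⇒coprime : ∀ {p d} → Prime p → ¬ p ∣ d → Coprime p d
prime∤⇒coprime p-prime p∤d (c∣p , c∣d) with prime⇒irreducible p-prime c∣p
... | inj₁ c≡1  = c≡1
... | inj₂ refl = ⊥-elim (p∤d c∣d)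

small-multiple : ∀ {d r} → r < d → d ∣ r → r ≡ 0
small-multiple {r = zero}  _   _   = refl
small-multiple {r = suc r} r<d d∣r = ⊥-elim (ℕₚ.<⇒≱ r<d (∣⇒≤ d∣r))

∣-consecutive : ∀ {d k} → d ∣ k → d ∣ suc k → d ≡ 1
∣-consecutive {d} {k} d∣k d∣k+1 = ∣1⇒≡1 (∣m+n∣m⇒∣n (subst (d ∣_) (ℕₚ.+-comm 1 k) d∣k+1) d∣k)

1∤-absurd : ∀ {d m} → d ≡ 1 → ¬ d ∣ m → ⊥
1∤-absurd {m = m} refl 1∤m = 1∤m (1∣ m)

monotone-off-multiples : ∀ d (f : ℕ → ℕ) →
  (∀ k → ¬ d ∣ k → ¬ d ∣ suc k → f k ≤ f (suc k)) →
  (∀ k → d ∣ suc k → ¬ d ∣ suc (suc k) → f k ≤ f (suc (suc k))) →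
  ∀ {k′ k} → k′ ≤ k → ¬ d ∣ k′ → ¬ d ∣ k → f k′ ≤ f k
monotone-off-multiples d f unit jump {k′} {k} k′≤k d∤k′ d∤k with ℕₚ.m≤n⇒m<n∨m≡n k′≤k
... | inj₂ refl = ℕₚ.≤-refl
... | inj₁ (s≤s {n = k₁} k′≤k₁) with d ∣? k₁
...   | no d∤k₁ =
  ℕₚ.≤-trans (monotone-off-multiples d f unit jump k′≤k₁ d∤k′ d∤k₁) (unit k₁ d∤k₁ d∤k)
...   | yes d∣k₁ with k₁
...     | zero   = ⊥-elim (d∤k′ (subst (d ∣_) (sym (ℕₚ.n≤0⇒n≡0 k′≤k₁)) d∣k₁))
...     | suc k₂ =
  ℕₚ.≤-trans (monotone-off-multiples d f unit jump k′≤k₂ d∤k′ d∤k₂) (jump k₂ d∣k₁ d∤k)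
  where
  k′≤k₂ : k′ ≤ k₂
  k′≤k₂ = ℕₚ.≤-pred (ℕₚ.≤∧≢⇒< k′≤k₁ (λ { refl → d∤k′ d∣k₁ }))
  d∤k₂ : ¬ d ∣ k₂
  d∤k₂ d∣k₂ = 1∤-absurd (∣-consecutive d∣k₂ d∣k₁) d∤k

≤-from-balance : ∀ {a b c e} → a + b ≡ c + e → b ≤ e → c ≤ a
≤-from-balance {a} {b} {c} {e} eq b≤e =
  ℕₚ.+-cancelʳ-≤ b c a (ℕₚ.≤-trans (ℕₚ.+-monoʳ-≤ c b≤e) (ℕₚ.≤-reflexive (sym eq)))

≤-from-balance₂ : ∀ {a b c e b′ f e′} → a + b ≡ c + e → c + b′ ≡ f + e′ →
                  b ≤ e′ → b′ ≤ e → f ≤ a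
≤-from-balance₂ {a} {b} {c} {e} {b′} {f} {e′} eq eq′ b≤e′ b′≤e =
  ≤-from-balance chained (ℕₚ.+-mono-≤ b≤e′ b′≤e)
  where
  chained : a + (b + b′) ≡ f + (e′ + e)
  chained = begin
    a + (b + b′)   ≡⟨ ℕₚ.+-assoc a b b′ ⟨
    a + b + b′     ≡⟨ cong (_+ b′) eq ⟩
    c + e + b′     ≡⟨ swap-last c e b′ ⟩
    c + b′ + e     ≡⟨ cong (_+ e) eq′ ⟩
    f + e′ + e     ≡⟨ ℕₚ.+-assoc f e′ e ⟩
    f + (e′ + e)   ∎
    where
    swap-last : ∀ x y z → x + y + z ≡ x + z + y
    swap-last = ℕ-Solver.solve-∀

module Modulus (c : ℕ) where

  d : ℕ
  d = suc c

  infixl 6 _↓_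
  _↓_ : ℤ → ℕ → ℤ
  x ↓ t = x ℤ.- + (t * d)

  ↓-suc : ∀ x t → x ↓ suc t ≡ (x ℤ.- + d) ↓ t
  ↓-suc x t = trans (cong (ℤ._-_ x) (ℤₚ.pos-+ d (t * d))) (regroup x (+ d) (+ (t * d)))
    where
    regroup : ∀ x a b → x ℤ.- (a ℤ.+ b) ≡ (x ℤ.- a) ℤ.- b
    regroup = ℤ-Solver.solve-∀

  -- H^{(n)}_x as a natural number: the terms h_{x−td} with t > x vanish.
  Hℕ : ℕ → ℤ → ℕ
  Hℕ n (+ m)    = ∑ (λ t → h n d (+ m ↓ t)) (suc m)
  Hℕ n -[1+ _ ] = 0

  H≡Hℕ : ∀ n x → H n d x ≡ + Hℕ n x
  H≡Hℕ n (+ m)    = cong (λ l → + sum l) (Listₚ.map-upTo (λ t → h n d (+ m ↓ t)) (suc m))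
  H≡Hℕ n -[1+ _ ] = refl

  Hℕ-neg : ∀ n x → x ℤ.< 0ℤ → Hℕ n x ≡ 0
  Hℕ-neg n -[1+ _ ] _        = refl
  Hℕ-neg n (+ _)    (ℤ.+<+ ())

  Hℕ-as-sum : ∀ n x N → x ℤ.< + N → Hℕ n x ≡ ∑ (λ t → h n d (x ↓ t)) N
  Hℕ-as-sum n -[1+ k ] N _ =
    sym (∑-zero (λ t → h-neg n d _ (ℤₚ.≤-<-trans (sub-≤ -[1+ k ] (t * d)) ℤ.-<+)) N)
  Hℕ-as-sum n (+ m) N (ℤ.+<+ m<N) = sym (∑-truncate _ m<N vanish)
    where
    vanish : ∀ t → m < t → h n d (+ m ↓ t) ≡ 0
    vanish t m<t = h-neg n d _ (sub-neg (ℕₚ.<-≤-trans m<t (ℕₚ.m≤m*n t d)))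

  H-unfold : ∀ n x → Hℕ n x ≡ h n d x + Hℕ n (x ℤ.- + d)
  H-unfold n x = begin
    Hℕ n x
      ≡⟨ Hℕ-as-sum n x (suc N) (ℤₚ.<-trans x<N (ℤ.+<+ (ℕₚ.n<1+n N))) ⟩
    h n d (x ↓ 0) + ∑ (λ t → h n d (x ↓ suc t)) N
      ≡⟨ cong₂ _+_ (cong (h n d) (ℤₚ.+-identityʳ x)) (∑-cong (λ t → cong (h n d) (↓-suc x t)) N) ⟩
    h n d x + ∑ (λ t → h n d ((x ℤ.- + d) ↓ t)) N
      ≡⟨ cong (_+_ (h n d x)) (Hℕ-as-sum n (x ℤ.- + d) N (ℤₚ.≤-<-trans (sub-≤ x d) x<N)) ⟨
    h n d x + Hℕ n (x ℤ.- + d) ∎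
    where
    N = suc ∣ x ∣
    x<N = below-bound x

  H-shift : ∀ n x → Hℕ n (x ℤ.- + d) ≤ Hℕ n x
  H-shift n x = subst (Hℕ n (x ℤ.- + d) ≤_) (sym (H-unfold n x)) (ℕₚ.m≤n+m _ (h n d x))

  -- Summing h-step along x, x − d, x − 2d, …:
  -- H^{(n+1)}_x + H^{(n)}_{x−d} = H^{(n+1)}_{x−1} + H^{(n)}_{x−1}.
  H-step : ∀ n x → Hℕ (suc n) x + Hℕ n (x ℤ.- + d) ≡ Hℕ (suc n) (x ℤ.- 1ℤ) + Hℕ n (x ℤ.- 1ℤ)
  H-step n x = begin
    Hℕ (suc n) x + Hℕ n (x ℤ.- + d)
      ≡⟨ cong₂ _+_ (Hℕ-as-sum (suc n) x N x<N) (Hℕ-as-sum n (x ℤ.- + d) N (lowered<N d)) ⟩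
    ∑ (λ t → h (suc n) d (x ↓ t)) N + ∑ (λ t → h n d ((x ℤ.- + d) ↓ t)) N
      ≡⟨ ∑-+ (λ t → h (suc n) d (x ↓ t)) (λ t → h n d ((x ℤ.- + d) ↓ t)) N ⟨
    ∑ (λ t → h (suc n) d (x ↓ t) + h n d ((x ℤ.- + d) ↓ t)) N
      ≡⟨ ∑-cong termwise N ⟩
    ∑ (λ t → h (suc n) d ((x ℤ.- 1ℤ) ↓ t) + h n d ((x ℤ.- 1ℤ) ↓ t)) N
      ≡⟨ ∑-+ (λ t → h (suc n) d ((x ℤ.- 1ℤ) ↓ t)) (λ t → h n d ((x ℤ.- 1ℤ) ↓ t)) N ⟩
    ∑ (λ t → h (suc n) d ((x ℤ.- 1ℤ) ↓ t)) N + ∑ (λ t → h n d ((x ℤ.- 1ℤ) ↓ t)) N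
      ≡⟨ cong₂ _+_ (Hℕ-as-sum (suc n) (x ℤ.- 1ℤ) N (lowered<N 1))
                   (Hℕ-as-sum n (x ℤ.- 1ℤ) N (lowered<N 1)) ⟨
    Hℕ (suc n) (x ℤ.- 1ℤ) + Hℕ n (x ℤ.- 1ℤ) ∎
    where
    N = suc ∣ x ∣
    x<N = below-bound x
    lowered<N : ∀ k → x ℤ.- + k ℤ.< + N
    lowered<N k = ℤₚ.≤-<-trans (sub-≤ x k) x<N
    termwise : ∀ t → h (suc n) d (x ↓ t) + h n d ((x ℤ.- + d) ↓ t) ≡
                     h (suc n) d ((x ℤ.- 1ℤ) ↓ t) + h n d ((x ℤ.- 1ℤ) ↓ t)
    termwise t = begin
      h (suc n) d (x ↓ t) + h n d ((x ℤ.- + d) ↓ t)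
        ≡⟨ cong (λ y → h (suc n) d (x ↓ t) + h n d y) (sub-swap x (+ d) (+ (t * d))) ⟩
      h (suc n) d (x ↓ t) + h n d ((x ↓ t) ℤ.- + d)
        ≡⟨ h-step n c (x ↓ t) ⟩
      h (suc n) d ((x ↓ t) ℤ.- 1ℤ) + h n d ((x ↓ t) ℤ.- 1ℤ)
        ≡⟨ cong (λ y → h (suc n) d y + h n d y) (sub-swap x (+ (t * d)) 1ℤ) ⟩
      h (suc n) d ((x ℤ.- 1ℤ) ↓ t) + h n d ((x ℤ.- 1ℤ) ↓ t) ∎

  -- Bounding H at x − e, where x − e may be negative (and H then vanishes).
  Hℕ-sub-≤ : ∀ n x e k → (e ≤ x → Hℕ n (+ (x ∸ e)) ≤ Hℕ n (+ k)) →
             Hℕ n (+ x ℤ.- + e) ≤ Hℕ n (+ k)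
  Hℕ-sub-≤ n x e k bound with e ≤? x
  ... | yes e≤x = subst (λ y → Hℕ n y ≤ Hℕ n (+ k)) (sym (sub-nat e≤x)) (bound e≤x)
  ... | no  e≰x = subst (_≤ Hℕ n (+ k)) (sym (Hℕ-neg n _ (sub-neg (ℕₚ.≰⇒> e≰x)))) z≤n

  ∤-sub : ∀ {k} → d ≤ k → ¬ d ∣ k → ¬ d ∣ (k ∸ d)
  ∤-sub d≤k d∤k d∣k-d = d∤k (∣m∸n∣n⇒∣m d d≤k d∣k-d ∣-refl)

  -- H^{(0)}_k = Σ_t [k = td] vanishes off the multiples of d.
  H₀-vanishes : ∀ k → ¬ d ∣ k → Hℕ 0 (+ k) ≡ 0
  H₀-vanishes k d∤k = ∑-zero (λ t → h-zero d (+ k ↓ t) (k≢td t)) (suc k)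
    where
    k≢td : ∀ t → + k ↓ t ≢ 0ℤ
    k≢td t k-td≡0 = d∤k (divides t (ℤₚ.+-injective (ℤₚ.i-j≡0⇒i≡j (+ k) _ k-td≡0)))

  H-mono : ∀ n {k′ k} → k′ ≤ k → ¬ d ∣ k′ → ¬ d ∣ k → Hℕ n (+ k′) ≤ Hℕ n (+ k)
  H-mono zero    {k′} {k} _ d∤k′ _ = subst (_≤ Hℕ 0 (+ k)) (sym (H₀-vanishes k′ d∤k′)) z≤n
  H-mono (suc n) = monotone-off-multiples d (λ k → Hℕ (suc n) (+ k)) unit jump
    where
    unit : ∀ k → ¬ d ∣ k → ¬ d ∣ suc k → Hℕ (suc n) (+ k) ≤ Hℕ (suc n) (+ suc k)
    unit k d∤k d∤k+1 = ≤-from-balance (H-step n (+ suc k))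
      (Hℕ-sub-≤ n (suc k) d k (λ d≤k+1 → H-mono n (ℕₚ.m∸n≤m k c) (∤-sub d≤k+1 d∤k+1) d∤k))

    jump : ∀ k → d ∣ suc k → ¬ d ∣ suc (suc k) → Hℕ (suc n) (+ k) ≤ Hℕ (suc n) (+ suc (suc k))
    jump k d∣k+1 d∤k+2 = ≤-from-balance₂ (H-step n (+ suc (suc k))) (H-step n (+ suc k))
      (Hℕ-sub-≤ n (suc (suc k)) d k (λ d≤k+2 → H-mono n k+2-d≤k (∤-sub d≤k+2 d∤k+2) d∤k))
      (H-shift n (+ suc k))
      where
      d∤k : ¬ d ∣ k
      d∤k d∣k = 1∤-absurd (∣-consecutive d∣k d∣k+1) d∤k+2
      -- d ≠ 1, as d ∤ k + 2
      1≤c : 1 ≤ c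
      1≤c = ℕₚ.n≢0⇒n>0 (λ { refl → d∤k+2 (1∣ _) })
      k+2-d≤k : suc (suc k) ∸ d ≤ k
      k+2-d≤k = ℕₚ.∸-monoʳ-≤ (suc k) 1≤c

  mul-mod : ∀ p x → (p * (x % d)) % d ≡ (p * x) % d
  mul-mod p x = begin
    (p * (x % d)) % d              ≡⟨ %-distribˡ-* p (x % d) d ⟩
    ((p % d) * (x % d % d)) % d    ≡⟨ cong (λ z → ((p % d) * z) % d) (m%n%n≡m%n x d) ⟩
    ((p % d) * (x % d)) % d        ≡⟨ %-distribˡ-* p x d ⟨
    (p * x) % d                    ∎

  inverse-exists : ∀ p → Coprime p d → ∃ λ q → q < d × (p * q) % d ≡ 1 % d
  inverse-exists p cp with coprime-Bézout cp
  ... | Bézout.+- x y 1+yd≡xp = x % d , m%n<n x d , (begin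
    (p * (x % d)) % d    ≡⟨ mul-mod p x ⟩
    (p * x) % d          ≡⟨ cong (_% d) (trans (ℕₚ.*-comm p x) (sym 1+yd≡xp)) ⟩
    (1 + y * d) % d      ≡⟨ [m+kn]%n≡m%n 1 y d ⟩
    1 % d                ∎)
  ... | Bézout.-+ x y 1+xp≡yd = x * c % d , m%n<n (x * c) d , (begin
    (p * (x * c % d)) % d   ≡⟨ mul-mod p (x * c) ⟩
    (p * (x * c)) % d       ≡⟨ [m+n]%n≡m%n (p * (x * c)) d ⟨
    (p * (x * c) + d) % d   ≡⟨ cong (_% d) shifted ⟩
    (1 + y * c * d) % d     ≡⟨ [m+kn]%n≡m%n 1 (y * c) d ⟩
    1 % d                   ∎)
    where
    shifted : p * (x * c) + d ≡ 1 + y * c * d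
    shifted = begin
      p * (x * c) + suc c    ≡⟨ expand p x c ⟩
      (1 + x * p) * c + 1    ≡⟨ cong (λ z → z * c + 1) 1+xp≡yd ⟩
      y * suc c * c + 1      ≡⟨ reorder y c ⟩
      1 + y * c * suc c      ∎
      where
      expand : ∀ p x c → p * (x * c) + suc c ≡ (1 + x * p) * c + 1
      expand = ℕ-Solver.solve-∀
      reorder : ∀ y c → y * suc c * c + 1 ≡ 1 + y * c * suc c
      reorder = ℕ-Solver.solve-∀

  invMod-spec : ∀ p → Coprime p d → (p * invMod p d) % d ≡ 1 % d
  invMod-spec p cp with inverse-exists p cp
  ... | q₀ , q₀<d , q₀-inverse = first-satisfies
    where
    is-inverse? = λ q → ((p * q) % d) ≟ (1 % d)
    q₀∈ : q₀ ∈ filter is-inverse? (upTo d)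
    q₀∈ = ∈-filter⁺ is-inverse? (∈-upTo⁺ q₀<d) q₀-inverse
    -- invMod returns the first element of this (non-empty) filtered list
    first-satisfies : (p * invMod p d) % d ≡ 1 % d
    first-satisfies with filter (λ q → ((p * q) % d) ≟ (1 % d)) (upTo d) in eq | q₀∈
    ... | []    | ()
    ... | q ∷ _ | _ = proj₂ (∈-filter⁻ is-inverse? {xs = upTo d} (subst (q ∈_) (sym eq) (here refl)))

  inverse-cancel : ∀ p q j → (p * q) % d ≡ 1 % d → d ∣ q * j → d ∣ j
  inverse-cancel p q j pq≡1 d∣qj = m%n≡0⇒n∣m j d (begin
    j % d                            ≡⟨ cong (_% d) (ℕₚ.*-identityˡ j) ⟨
    (1 * j) % d                      ≡⟨ %-distribˡ-* 1 j d ⟩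
    ((1 % d) * (j % d)) % d          ≡⟨ cong (λ z → (z * (j % d)) % d) pq≡1 ⟨
    (((p * q) % d) * (j % d)) % d    ≡⟨ %-distribˡ-* (p * q) j d ⟨
    (p * q * j) % d                  ≡⟨ cong (_% d) (ℕₚ.*-assoc p q j) ⟩
    (p * (q * j)) % d                ≡⟨ n∣m⇒m%n≡0 _ d (∣n⇒∣m*n p d∣qj) ⟩
    0                                ∎)

  residue : ℕ → ℕ → ℕ
  residue p j = (+ j ℤ.- + (invMod p d * j)) %ℕ d

  σ-cases : ∀ p j → σ0 p d j ≡ residue p j ⊎ (σ0 p d j ≡ d × residue p j ≡ 0)
  σ-cases p j with ((p ∸ 1) * j) % d ≟ 0 | residue p j ≟ 0
  ... | yes _ | yes r≡0 = inj₂ (refl , r≡0)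
  ... | yes _ | no  _   = inj₁ refl
  ... | no  _ | _       = inj₁ refl

  σ-≤ : ∀ p j → σ0 p d j ≤ d
  σ-≤ p j with σ-cases p j
  ... | inj₁ σ≡r       = subst (_≤ d) (sym σ≡r) (ℕₚ.<⇒≤ (n%ℕd<d (+ j ℤ.- + (invMod p d * j)) d))
  ... | inj₂ (σ≡d , _) = ℕₚ.≤-reflexive σ≡d

  ∣-sub-residue : ∀ a → + d ∣ℤ a ℤ.- + (a %ℕ d)
  ∣-sub-residue a = ℤ∣.divides (a /ℕ d)
    (trans (cong (ℤ._- + (a %ℕ d)) (a≡a%ℕn+[a/ℕn]*n a d)) (cancel (+ (a %ℕ d)) (a /ℕ d) (+ d)))
    where
    cancel : ∀ r q e → (r ℤ.+ q ℤ.* e) ℤ.- r ≡ q ℤ.* e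
    cancel = ℤ-Solver.solve-∀

  %ℕ-of-multiple : ∀ a → + d ∣ℤ a → a %ℕ d ≡ 0
  %ℕ-of-multiple a d∣a = small-multiple (n%ℕd<d a d) (ℤ∣.∣⇒∣ᵤ d∣r)
    where
    d∣r : + d ∣ℤ + (a %ℕ d)
    d∣r = subst (+ d ∣ℤ_) (sub-sub a (+ (a %ℕ d))) (ℤ∣.∣m∣n⇒∣m-n d∣a (∣-sub-residue a))

  residue-of-multiple : ∀ p j → d ∣ j → residue p j ≡ 0
  residue-of-multiple p j d∣j = %ℕ-of-multiple (+ j ℤ.- + (q * j))
    (ℤ∣.∣m∣n⇒∣m-n {m = + j} (ℤ∣.∣ᵤ⇒∣ d∣j) (ℤ∣.∣ᵤ⇒∣ {i = + (q * j)} (∣n⇒∣m*n q d∣j)))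
    where
    q = invMod p d

  σ-multiple : ∀ p j → d ∣ j → σ0 p d j ≡ d
  σ-multiple p j d∣j with ((p ∸ 1) * j) % d ≟ 0 | residue p j ≟ 0
  ... | yes _ | yes _   = refl
  ... | yes _ | no  r≢0 = ⊥-elim (r≢0 (residue-of-multiple p j d∣j))
  ... | no  ≢0  | _     = ⊥-elim (≢0 (n∣m⇒m%n≡0 _ d (∣n⇒∣m*n (p ∸ 1) d∣j)))

  σ-congruence : ∀ p j → + d ∣ℤ (+ j ℤ.- + σ0 p d j) ℤ.- + (invMod p d * j)
  σ-congruence p j = subst (+ d ∣ℤ_) (regroup (+ j) (+ σ0 p d j) (+ (q * j)) (+ residue p j))
    (ℤ∣.∣m∣n⇒∣m+n (∣-sub-residue (+ j ℤ.- + (q * j))) residue≡σ)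
    where
    q = invMod p d
    regroup : ∀ j s q r → ((j ℤ.- q) ℤ.- r) ℤ.+ (r ℤ.- s) ≡ (j ℤ.- s) ℤ.- q
    regroup = ℤ-Solver.solve-∀
    residue≡σ : + d ∣ℤ + residue p j ℤ.- + σ0 p d j
    residue≡σ with σ-cases p j
    ... | inj₁ σ≡r rewrite σ≡r = ℤ∣.divides 0ℤ (ℤₚ.+-inverseʳ (+ residue p j))
    ... | inj₂ (σ≡d , r≡0) rewrite σ≡d | r≡0 = ℤ∣.divides -1ℤ (sym (ℤₚ.-1*i≡-i (+ d)))

  -- For j not a multiple of d, neither is j − σ_j(0), since p⁻¹ is invertible.
  σ-off-multiples : ∀ p j → Coprime p d → ¬ d ∣ j → σ0 p d j ≤ j → ¬ d ∣ (j ∸ σ0 p d j)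
  σ-off-multiples p j cp d∤j σ≤j d∣j-σ =
    d∤j (inverse-cancel p q j (invMod-spec p cp) (ℤ∣.∣⇒∣ᵤ d∣qj))
    where
    q = invMod p d
    d∣j-σ′ : + d ∣ℤ + j ℤ.- + σ0 p d j
    d∣j-σ′ = subst (+ d ∣ℤ_) (sym (sub-nat σ≤j)) (ℤ∣.∣ᵤ⇒∣ d∣j-σ)
    d∣qj : + d ∣ℤ + (q * j)
    d∣qj = subst (+ d ∣ℤ_) (sub-sub (+ j ℤ.- + σ0 p d j) (+ (q * j)))
                 (ℤ∣.∣m∣n⇒∣m-n d∣j-σ′ (σ-congruence p j))

  -- H_{j−σ} ≤ H_j, i.e. h_{j,0} ≥ 0: for d ∣ j this is H-shift, otherwise
  -- j − σ ≤ j are non-multiples of d (or j − σ < 0).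
  H-frob0 : ∀ n p j → Coprime p d → Hℕ n (+ j ℤ.- + σ0 p d j) ≤ Hℕ n (+ j)
  H-frob0 n p j cp with d ∣? j
  ... | yes d∣j rewrite σ-multiple p j d∣j = H-shift n (+ j)
  ... | no  d∤j = Hℕ-sub-≤ n j (σ0 p d j) j (λ σ≤j →
        H-mono n (ℕₚ.m∸n≤m j (σ0 p d j)) (σ-off-multiples p j cp d∤j σ≤j) d∤j)

  -- H_{j−d} ≤ H_{j−σ}, i.e. h_{j,1} ≥ 0: trivial for d ∣ j, otherwise
  -- j − d ≤ j − σ are non-multiples of d (or j − d < 0).
  H-frob1 : ∀ n p j → Coprime p d → Hℕ n (+ j ℤ.- + d) ≤ Hℕ n (+ j ℤ.- + σ0 p d j)
  H-frob1 n p j cp with d ∣? j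
  ... | yes d∣j rewrite σ-multiple p j d∣j = ℕₚ.≤-refl
  ... | no  d∤j with σ0 p d j ≤? j
  ...   | yes σ≤j rewrite sub-nat σ≤j = Hℕ-sub-≤ n j d (j ∸ σ0 p d j) (λ d≤j →
          H-mono n (ℕₚ.∸-monoʳ-≤ j (σ-≤ p j)) (∤-sub d≤j d∤j) (σ-off-multiples p j cp d∤j σ≤j))
  ...   | no  σ≰j = subst (_≤ Hℕ n (+ j ℤ.- + σ0 p d j)) (sym (Hℕ-neg n _ (sub-neg j<d))) z≤n
    where
    j<d : j < d
    j<d = ℕₚ.<-≤-trans (ℕₚ.≰⇒> σ≰j) (σ-≤ p j)

  H-difference-nonneg : ∀ n x y → Hℕ n y ≤ Hℕ n x → + 0 ≤ℤ H n d x ℤ.- H n d y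
  H-difference-nonneg n x y y≤x rewrite H≡Hℕ n x | H≡Hℕ n y = ℤₚ.i≤j⇒0≤j-i (ℤ.+≤+ y≤x)

  frobenius-nonneg : ∀ n p → Prime p → ¬ p ∣ d → ∀ j →
                     (+ 0 ≤ℤ hFrob0 n d p j) × (+ 0 ≤ℤ hFrob1 n d p j)
  frobenius-nonneg n p p-prime p∤d j =
    H-difference-nonneg n (+ j) (+ j ℤ.- + σ0 p d j) (H-frob0 n p j coprime) ,
    H-difference-nonneg n (+ j ℤ.- + σ0 p d j) (+ j ℤ.- + d) (H-frob1 n p j coprime)
    where
    coprime = prime∤⇒coprime p-prime p∤d

mainTheorem8 : (n d p : ℕ) → .{{_ : NonZero n}} → .{{_ : NonZero d}} →
    Prime p → ¬ (p ∣ d) →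
    (j : ℕ) → j ≤ n * d →
    (+ 0 ≤ℤ hFrob0 n d p j) × (+ 0 ≤ℤ hFrob1 n d p j)
-- d = 0 is excluded by NonZero d.
mainTheorem8 n zero    p {{_}} {{d≢0}} _ _ _ _ = ⊥-elim (ℕ.≢-nonZero⁻¹ 0 {{d≢0}} refl)
mainTheorem8 n (suc c) p p-prime p∤d j _       = Modulus.frobenius-nonneg c n p p-prime p∤d j
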